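{- Let $\mathbf P=(P,\le)$ be a poset such that the lattice $\mathbf D_0(\mathbf P)$ is modular. Then $\mathbf P$ is strongly modular.
   Context: For $A\subseteq P$, $L(A)=\{x\in P\mid x\le y\ \forall y\in A\}$, $U(A)=\{x\in P\mid x\ge y\ \forall y\in A\}$; write $L(a,b)=L(\{a,b\})$, $L(a,A)=L(\{a\}\cup A)$, $L(A,B)=L(A\cup B)$, $LU(A)=L(U(A))$, and similarly. The Dedekind–MacNeille completion $\mathbf D(\mathbf P)=(D(\mathbf P),\subseteq)$, $D(\mathbf P)=\{A\subseteq P\mid LU(A)=A\}$, is a complete lattice with $A\vee B=LU(A\cup B)$, $A\wedge B=A\cap B$; $P$ is embedded via $x\mapsto L(x)$, and $\mathbf D_0(\mathbf P)$ is the sublattice of $\mathbf D(\mathbf P)$ generated by $\{L(x)\mid x\in P\}$. A poset is strongly modular if for all $x,y,z\in P$: $L(U(x,y),U(x,z))=LU(x,L(y,U(x,z)))$ and $L(U(L(x,z),y),z)=LU(L(x,z),L(y,z))$. -}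

module Defs where

open import Level using (Level; _⊔_)
open import Data.Sum using (_⊎_)
open import Relation.Binary.Bundles using (Poset)
open import Relation.Unary using (Pred; _∪_; _⊆_; _≐_; _∩_)

module PosetDefs {c ℓ₁ ℓ₂ : Level} (P : Poset c ℓ₁ ℓ₂) where
  open Poset P

  Sub : Set _
  Sub = Pred Carrier (c ⊔ ℓ₁ ⊔ ℓ₂)

  ⟨_⟩ : Carrier → Sub
  ⟨ x ⟩ z = Level.Lift (c ⊔ ℓ₂) (z ≈ x)

  ⟨_,_⟩ : Carrier → Carrier → Sub
  ⟨ x , y ⟩ = ⟨ x ⟩ ∪ ⟨ y ⟩

  L : Sub → Sub
  L A x = ∀ y → A y → x ≤ y

  U : Sub → Sub
  U A x = ∀ y → A y → y ≤ x

  LU : Sub → Sub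
  LU A = L (U A)

  -- Dedekind–MacNeille completion: the closed subsets
  InD : Sub → Set _
  InD A = LU A ≐ A

  _∨D_ : Sub → Sub → Sub
  A ∨D B = LU (A ∪ B)

  _∧D_ : Sub → Sub → Sub
  A ∧D B = A ∩ B

  -- lattice terms over P; their interpretations are exactly the elements
  -- of the sublattice D₀(P) of D(P) generated by { L(x) | x ∈ P }
  data D₀Term : Set c where
    gen  : Carrier → D₀Term
    _⊓_  : D₀Term → D₀Term → D₀Term
    _⊔ₜ_ : D₀Term → D₀Term → D₀Term

  ⟦_⟧ : D₀Term → Sub
  ⟦ gen x ⟧    = L ⟨ x ⟩
  ⟦ s ⊓ t ⟧    = ⟦ s ⟧ ∧D ⟦ t ⟧
  ⟦ s ⊔ₜ t ⟧   = ⟦ s ⟧ ∨D ⟦ t ⟧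

  D₀Modular : Set _
  D₀Modular = ∀ a b d → ⟦ a ⟧ ⊆ ⟦ d ⟧ →
    ((⟦ a ⟧ ∨D ⟦ b ⟧) ∧D ⟦ d ⟧) ≐ (⟦ a ⟧ ∨D (⟦ b ⟧ ∧D ⟦ d ⟧))

  StronglyModular : Set _
  StronglyModular = ∀ x y z →
    (L (U ⟨ x , y ⟩ ∪ U ⟨ x , z ⟩) ≐ LU (⟨ x ⟩ ∪ L (⟨ y ⟩ ∪ U ⟨ x , z ⟩)))
    × (L (U (L ⟨ x , z ⟩ ∪ ⟨ y ⟩) ∪ ⟨ z ⟩) ≐ LU (L ⟨ x , z ⟩ ∪ L ⟨ y , z ⟩))
    where open import Data.Product using (_×_)

module Submission where

open import Defs
-- ⟨_,_⟩ from Defs makes the pair constructor _,_ ambiguous.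
open import Data.Product using (proj₂) renaming (_,_ to _&_)
open import Function using (_∘_)
open import Data.Sum using (inj₁; inj₂; [_,_])
open import Level using (Level; _⊔_; lift)
open import Relation.Binary.Bundles using (Poset)
import Relation.Binary.Reasoning.Setoid as SetoidReasoning
open import Relation.Unary using (_∪_; _∩_; _⊆_; _≐_)
open import Relation.Unary.Algebra using (∩-cong; ∪-cong)
open import Relation.Unary.Properties using (≐-refl; ≐-sym; ≐-trans)
open import Relation.Unary.Relation.Binary.Equality using (≐-setoid)

-- Both identities are the modular law of D₀(P), instantiated at the terms
-- L x ≤ L x ∨ L z with L y, and at L x ∧ L z ≤ L z with L y, once the cones
-- in the statement are rewritten as joins and meets of principal ideals.

module _ {c ℓ₁ ℓ₂ : Level} (P : Poset c ℓ₁ ℓ₂) where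
  open Poset P
  open PosetDefs P
  open SetoidReasoning (≐-setoid Carrier (c ⊔ ℓ₁ ⊔ ℓ₂))

  L-antitone : {A B : Sub} → A ⊆ B → L B ⊆ L A
  L-antitone A⊆B x≤B y y∈A = x≤B y (A⊆B y∈A)

  U-antitone : {A B : Sub} → A ⊆ B → U B ⊆ U A
  U-antitone A⊆B B≤x y y∈A = B≤x y (A⊆B y∈A)

  L-cong : {A B : Sub} → A ≐ B → L A ≐ L B
  L-cong (A⊆B & B⊆A) = L-antitone B⊆A & L-antitone A⊆B

  U-cong : {A B : Sub} → A ≐ B → U A ≐ U B
  U-cong (A⊆B & B⊆A) = U-antitone B⊆A & U-antitone A⊆B

  L-∪ : {A B : Sub} → L (A ∪ B) ≐ (L A ∩ L B)
  L-∪ = (λ x≤A∪B → (λ y → x≤A∪B y ∘ inj₁) & (λ y → x≤A∪B y ∘ inj₂))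
      & (λ { (x≤A & x≤B) y → [ x≤A y , x≤B y ] })

  U-∪ : {A B : Sub} → U (A ∪ B) ≐ (U A ∩ U B)
  U-∪ = (λ A∪B≤x → (λ y → A∪B≤x y ∘ inj₁) & (λ y → A∪B≤x y ∘ inj₂))
      & (λ { (A≤x & B≤x) y → [ A≤x y , B≤x y ] })

  U-∪-cong : {A A′ B B′ : Sub} → U A ≐ U A′ → U B ≐ U B′ →
             U (A ∪ B) ≐ U (A′ ∪ B′)
  U-∪-cong UA≐UA′ UB≐UB′ = ≐-trans U-∪ (≐-trans (∩-cong UA≐UA′ UB≐UB′) (≐-sym U-∪))

  U-principal : (x : Carrier) → U ⟨ x ⟩ ≐ U (L ⟨ x ⟩)
  U-principal x =
      (λ x≤u w w≤x → trans (w≤x x (lift Eq.refl)) (x≤u x (lift Eq.refl)))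
    & (λ Lx≤u y (lift y≈x) →
         Lx≤u y (λ x′ (lift x′≈x) → reflexive (Eq.trans y≈x (Eq.sym x′≈x))))

  U-pair : (x y : Carrier) → U ⟨ x , y ⟩ ≐ U (L ⟨ x ⟩ ∪ L ⟨ y ⟩)
  U-pair x y = U-∪-cong (U-principal x) (U-principal y)

  LU-pair : (x y : Carrier) → LU ⟨ x , y ⟩ ≐ ⟦ gen x ⊔ₜ gen y ⟧
  LU-pair x y = L-cong (U-pair x y)

  L-pair : (x y : Carrier) → L ⟨ x , y ⟩ ≐ (L ⟨ x ⟩ ∩ L ⟨ y ⟩)
  L-pair x y = L-∪

  ⊆-∨Dˡ : {A B : Sub} → A ⊆ (A ∨D B)
  ⊆-∨Dˡ {x = a} a∈A u A∪B≤u = A∪B≤u a (inj₁ a∈A)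

  module _ (modular : D₀Modular) (x y z : Carrier) where
    private
      X Y Z : D₀Term
      X = gen x
      Y = gen y
      Z = gen z

    strongly-modular₁ :
      L (U ⟨ x , y ⟩ ∪ U ⟨ x , z ⟩) ≐ LU (⟨ x ⟩ ∪ L (⟨ y ⟩ ∪ U ⟨ x , z ⟩))
    strongly-modular₁ = begin
      L (U ⟨ x , y ⟩ ∪ U ⟨ x , z ⟩)         ≈⟨ L-∪ ⟩
      LU ⟨ x , y ⟩ ∩ LU ⟨ x , z ⟩           ≈⟨ ∩-cong (LU-pair x y) (LU-pair x z) ⟩
      ⟦ (X ⊔ₜ Y) ⊓ (X ⊔ₜ Z) ⟧               ≈⟨ modular X Y (X ⊔ₜ Z) ⊆-∨Dˡ ⟩
      ⟦ X ⊔ₜ (Y ⊓ (X ⊔ₜ Z)) ⟧               ≈⟨ L-cong (U-∪-cong (U-principal x) (U-cong ≐y⊓[x⊔z])) ⟨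
      LU (⟨ x ⟩ ∪ L (⟨ y ⟩ ∪ U ⟨ x , z ⟩))  ∎
      where
      ≐y⊓[x⊔z] : L (⟨ y ⟩ ∪ U ⟨ x , z ⟩) ≐ ⟦ Y ⊓ (X ⊔ₜ Z) ⟧
      ≐y⊓[x⊔z] = ≐-trans L-∪ (∩-cong ≐-refl (LU-pair x z))

    strongly-modular₂ :
      L (U (L ⟨ x , z ⟩ ∪ ⟨ y ⟩) ∪ ⟨ z ⟩) ≐ LU (L ⟨ x , z ⟩ ∪ L ⟨ y , z ⟩)
    strongly-modular₂ = begin
      L (U (L ⟨ x , z ⟩ ∪ ⟨ y ⟩) ∪ ⟨ z ⟩)   ≈⟨ L-∪ ⟩
      LU (L ⟨ x , z ⟩ ∪ ⟨ y ⟩) ∩ L ⟨ z ⟩    ≈⟨ ∩-cong ≐[x⊓z]⊔y ≐-refl ⟩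
      ⟦ ((X ⊓ Z) ⊔ₜ Y) ⊓ Z ⟧                ≈⟨ modular (X ⊓ Z) Y Z proj₂ ⟩
      ⟦ (X ⊓ Z) ⊔ₜ (Y ⊓ Z) ⟧                ≈⟨ L-cong (U-cong (∪-cong (L-pair x z) (L-pair y z))) ⟨
      LU (L ⟨ x , z ⟩ ∪ L ⟨ y , z ⟩)        ∎
      where
      ≐[x⊓z]⊔y : LU (L ⟨ x , z ⟩ ∪ ⟨ y ⟩) ≐ ⟦ (X ⊓ Z) ⊔ₜ Y ⟧
      ≐[x⊓z]⊔y = L-cong (U-∪-cong (U-cong (L-pair x z)) (U-principal y))

lemma11 : {c ℓ₁ ℓ₂ : Level} (P : Poset c ℓ₁ ℓ₂) →
    PosetDefs.D₀Modular P → PosetDefs.StronglyModular P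
lemma11 P modular x y z =
  strongly-modular₁ P modular x y z & strongly-modular₂ P modular x y z
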